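{- Let $G$ be a strongly connected compressed directed graph that is not a closed path. Then: (i) the set $\{V(\mathcal{M}_v): v \text{ a bivalent node of } G\}$ is a partition of $V(G)$; (ii) in a macronode $\mathcal{M}_v$, $R^+(v)$ and $R^-(v)$ induce two trees with common root $v$, oriented in opposite directions; except for the common root the two trees are node-disjoint, all nodes in $R^-(v)$ are join nodes and all nodes in $R^+(v)$ are split nodes; (iii) the only arcs whose endpoints lie in two different macronodes are bivalent arcs.
   Context: Graphs are finite directed multigraphs (parallel arcs and self-loops allowed); $t(e)$, $h(e)$ are tail and head of arc $e$. A path is a walk with distinct nodes except the last may equal the first. A closed path is a graph consisting of a single cycle. A node is a join node if its in-degree exceeds 1, a split node if its out-degree exceeds 1, bivalent if both, biunivocal if neither. An arc $e$ is a join arc if $h(e)$ is a join node (else join-free), a split arc if $t(e)$ is a split node (else split-free), bivalent if both, biunivocal if neither. A path is join-free (split-free) if all its arcs are. A graph is compressed if it has no biunivocal nodes and no biunivocal arcs. For a bivalent node $v$, $R^+(v)$ is the set of nodes $u$ such that there is a join-free path from $v$ to $u$, $R^-(v)$ is the set of nodes $u$ such that there is a split-free path from $u$ to $v$, and the macronode $\mathcal{M}_v$ is the subgraph induced by $R^+(v)\cup R^-(v)$. -}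

module Defs where

open import Data.Nat using (ℕ; _<_; _>_)
open import Data.Fin using (Fin; _≟_)
open import Data.List using (List; []; _∷_; length; filter; allFin)
open import Data.List.Relation.Unary.All using (All)
open import Data.List.Relation.Unary.Unique.Propositional using (Unique)
open import Data.List.Membership.Propositional using (_∈_)
open import Data.List.Relation.Binary.Permutation.Propositional using (_↭_)
open import Data.Product using (Σ; _×_; ∃)
open import Data.Sum using (_⊎_)
open import Data.Empty using (⊥)
open import Relation.Nullary using (¬_)
open import Relation.Binary.PropositionalEquality using (_≡_; _≢_)

record Graph : Set where
  field
    nNodes : ℕ
    nArcs  : ℕ
    tl     : Fin nArcs → Fin nNodes
    hd     : Fin nArcs → Fin nNodes
open Graph public

Node : Graph → Set
Node G = Fin (nNodes G)

Arc : Graph → Set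
Arc G = Fin (nArcs G)

indeg : (G : Graph) → Node G → ℕ
indeg G v = length (filter (λ e → hd G e ≟ v) (allFin (nArcs G)))

outdeg : (G : Graph) → Node G → ℕ
outdeg G v = length (filter (λ e → tl G e ≟ v) (allFin (nArcs G)))

JoinNode SplitNode BivalentNode BiunivocalNode : (G : Graph) → Node G → Set
JoinNode G v = indeg G v > 1
SplitNode G v = outdeg G v > 1
BivalentNode G v = JoinNode G v × SplitNode G v
BiunivocalNode G v = ¬ JoinNode G v × ¬ SplitNode G v

JoinArc SplitArc BivalentArc BiunivocalArc : (G : Graph) → Arc G → Set
JoinArc G e = JoinNode G (hd G e)
SplitArc G e = SplitNode G (tl G e)
BivalentArc G e = JoinArc G e × SplitArc G e
BiunivocalArc G e = ¬ JoinArc G e × ¬ SplitArc G e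

JoinFreeArc SplitFreeArc : (G : Graph) → Arc G → Set
JoinFreeArc G e = ¬ JoinArc G e
SplitFreeArc G e = ¬ SplitArc G e

data Walk (G : Graph) : Node G → Node G → Set where
  []   : ∀ {u} → Walk G u u
  step : ∀ {u w} (e : Arc G) → tl G e ≡ u → Walk G (hd G e) w → Walk G u w

nodes : ∀ {G u w} → Walk G u w → List (Node G)
nodes {u = u} []             = u ∷ []
nodes {u = u} (step e _ p)   = u ∷ nodes p

nodesInit : ∀ {G u w} → Walk G u w → List (Node G)
nodesInit []                 = []
nodesInit {u = u} (step e _ p) = u ∷ nodesInit p

nodesTail : ∀ {G u w} → Walk G u w → List (Node G)
nodesTail []             = []
nodesTail (step e _ p)   = nodes p

arcs : ∀ {G u w} → Walk G u w → List (Arc G)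
arcs []             = []
arcs (step e _ p)   = e ∷ arcs p

-- A path: the nodes v0 … vk are distinct, except that vk may equal v0.
-- (Exactly the pairs (vi,vj), i<j, other than (v0,vk) are required distinct,
--  i.e. v0…v(k-1) distinct and v1…vk distinct.)
IsPath : ∀ {G u w} → Walk G u w → Set
IsPath p = Unique (nodesInit p) × Unique (nodesTail p)

StronglyConnected : Graph → Set
StronglyConnected G = ∀ (u w : Node G) → Walk G u w

Compressed : Graph → Set
Compressed G = (∀ v → ¬ BiunivocalNode G v) × (∀ e → ¬ BiunivocalArc G e)

-- G is a closed path: G consists of a single cycle, i.e. there is a closed
-- path of positive length traversing every arc exactly once and every node.
IsClosedPath : Graph → Set
IsClosedPath G =
  Σ (Node G) λ v → Σ (Walk G v v) λ p →
    IsPath p × (0 < length (arcs p)) × (arcs p ↭ allFin (nArcs G))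
    × (∀ u → u ∈ nodes p)

Rplus : (G : Graph) → Node G → Node G → Set
Rplus G v u = Σ (Walk G v u) λ p → IsPath p × All (JoinFreeArc G) (arcs p)

Rminus : (G : Graph) → Node G → Node G → Set
Rminus G v u = Σ (Walk G u v) λ p → IsPath p × All (SplitFreeArc G) (arcs p)

-- node set of the macronode M_v (induced subgraph on R⁺(v) ∪ R⁻(v))
InMacro : (G : Graph) → Node G → Node G → Set
InMacro G v u = Rplus G v u ⊎ Rminus G v u

SameMacro : (G : Graph) → Node G → Node G → Set
SameMacro G v w = ∀ x → (InMacro G v x → InMacro G w x) × (InMacro G w x → InMacro G v x)

-- (S , A) is an out-tree (arborescence) rooted at r: the subgraph with node set
-- S and arcs those arcs of A with both ends in S; root has in-degree 0, every
-- other node in-degree exactly 1, and every node is reachable from r.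
OutTree : (G : Graph) → (Node G → Set) → (Arc G → Set) → Node G → Set
OutTree G S A r =
  S r
  × (∀ e → A e → hd G e ≡ r → S (tl G e) → ⊥)
  × (∀ u → S u → u ≢ r →
       Σ (Arc G) λ e → A e × hd G e ≡ u × S (tl G e)
         × (∀ e' → A e' → hd G e' ≡ u → S (tl G e') → e' ≡ e))
  × (∀ u → S u → Σ (Walk G r u) λ p → All A (arcs p) × All S (nodes p))

-- (S , A) is an in-tree rooted at r (all arcs oriented towards r): root has
-- out-degree 0, every other node out-degree exactly 1, every node reaches r.
InTree : (G : Graph) → (Node G → Set) → (Arc G → Set) → Node G → Set
InTree G S A r =
  S r
  × (∀ e → A e → tl G e ≡ r → S (hd G e) → ⊥)
  × (∀ u → S u → u ≢ r →
       Σ (Arc G) λ e → A e × tl G e ≡ u × S (hd G e)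
         × (∀ e' → A e' → tl G e' ≡ u → S (hd G e') → e' ≡ e))
  × (∀ u → S u → Σ (Walk G u r) λ p → All A (arcs p) × All S (nodes p))

-- A node that is not a split node has a unique out-arc, so a split-free walk is determined
-- by its source, and two split-free walks from one node that end at split nodes coincide.
-- Such a walk therefore never revisits a node, two bivalent nodes never share a node of their
-- R⁻, and R⁻(v) is an in-tree. Reversing all arcs exchanges joins and splits, turning R⁻ into
-- R⁺. In a compressed graph every node is a join or a split node; this pins the overlaps of
-- the trees to their roots and forces arcs between macronodes to be bivalent. For the cover,
-- a split node exists (otherwise every node has at least two in-arcs but at most one
-- out-arc), and the first split node on a walk from a join node u to it is bivalent, with u
-- in its R⁻.
module Submission where

open import Defs
open import Data.Nat using (suc; _<_; _≤_; _<?_; z≤n; s≤s)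
open import Data.Nat.Properties using (≤-refl; m≤n⇒m≤1+n; n<1+n; <-irrefl)
open import Data.Fin using (Fin; _≟_; punchOut)
open import Data.Fin.Properties using (pigeonhole; punchOut-injective; <⇒≢; any?)
open import Data.List using (List; []; _∷_; length; filter; allFin; reverse; _ʳ++_)
open import Data.List.Relation.Unary.All as All using (All; []; _∷_)
open import Data.List.Relation.Unary.All.Properties using (¬Any⇒All¬)
open import Data.List.Relation.Unary.Any using (here; there)
open import Data.List.Relation.Unary.AllPairs using ([]; _∷_)
open import Data.List.Relation.Unary.Unique.Propositional using (Unique)
open import Data.List.Relation.Unary.Unique.Propositional.Properties using (filter⁺; allFin⁺; Unique[x∷xs]⇒x∉xs)
open import Data.List.Membership.Propositional using (_∈_; _∉_)
open import Data.List.Membership.Propositional.Properties using (∈-filter⁺; ∈-filter⁻; ∈-allFin)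
open import Data.List.Relation.Binary.Permutation.Propositional using (↭-sym; ↭⇒↭ₛ)
open import Data.List.Relation.Binary.Permutation.Propositional.Properties using (All-resp-↭; ↭-reverse)
open import Data.List.Relation.Binary.Permutation.Setoid.Properties using (Unique-resp-↭)
open import Data.Product using (Σ; _×_; _,_; proj₁; proj₂; swap)
open import Data.Sum using (_⊎_; inj₁; inj₂)
open import Data.Empty using (⊥-elim)
open import Function using (_∘_)
open import Function.Definitions using (Injective)
open import Relation.Nullary using (¬_; Dec; yes; no)
open import Relation.Binary.PropositionalEquality using (_≡_; _≢_; refl; sym; trans; cong; subst; setoid)

All-reverse : ∀ {A : Set} {P : A → Set} {xs : List A} → All P xs → All P (reverse xs)
All-reverse {xs = xs} = All-resp-↭ (↭-sym (↭-reverse xs))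

Unique-reverse : ∀ {A : Set} {xs : List A} → Unique xs → Unique (reverse xs)
Unique-reverse {A} {xs} = Unique-resp-↭ (setoid A) (↭⇒↭ₛ (↭-sym (↭-reverse xs)))

distinct-∈⇒1<length : ∀ {A : Set} {xs : List A} {x y : A} → x ∈ xs → y ∈ xs → x ≢ y → 1 < length xs
distinct-∈⇒1<length {xs = _ ∷ []}    (here refl) (here refl) x≢y = ⊥-elim (x≢y refl)
distinct-∈⇒1<length {xs = _ ∷ _ ∷ _} _           _           _   = s≤s (s≤s z≤n)

Unique∧1<length⇒distinct-∈ : ∀ {A : Set} {xs : List A} → Unique xs → 1 < length xs →
  Σ A λ x → Σ A λ y → x ≢ y × x ∈ xs × y ∈ xs
Unique∧1<length⇒distinct-∈ {xs = x ∷ y ∷ _} ((x≢y ∷ _) ∷ _) _ = x , y , x≢y , here refl , there (here refl)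
Unique∧1<length⇒distinct-∈ {xs = _ ∷ []} _ (s≤s ())

injective⇒surjective : ∀ {n} {f : Fin n → Fin n} → Injective _≡_ _≡_ f → ∀ t → Σ (Fin n) λ i → f i ≡ t
injective⇒surjective {suc n} {f} f-inj t with any? (λ i → f i ≟ t)
... | yes hit = hit
... | no  ¬hit =
  let i , j , i<j , fi≡fj = pigeonhole (n<1+n n) (λ k → punchOut (t≢f k))
  in ⊥-elim (<⇒≢ i<j (f-inj (punchOut-injective (t≢f i) (t≢f j) fi≡fj)))
  where
  t≢f : ∀ i → t ≢ f i
  t≢f i t≡fi = ¬hit (i , sym t≡fi)

-- In G ᵒᵖ, join and split notions are exchanged definitionally, so each dual statement below
-- is the original one applied to G ᵒᵖ.
_ᵒᵖ : Graph → Graph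
G ᵒᵖ = record { nNodes = nNodes G ; nArcs = nArcs G ; tl = hd G ; hd = tl G }

nodes≡∷nodesTail : ∀ {G a b} (p : Walk G a b) → nodes p ≡ a ∷ nodesTail p
nodes≡∷nodesTail []           = refl
nodes≡∷nodesTail (step _ _ _) = refl

module _ {G : Graph} where

  reverseOnto : ∀ {a b c} → Walk G a b → Walk (G ᵒᵖ) a c → Walk (G ᵒᵖ) b c
  reverseOnto []              acc = acc
  reverseOnto (step e refl p) acc = reverseOnto p (step e refl acc)

  reverseWalk : ∀ {a b} → Walk G a b → Walk (G ᵒᵖ) b a
  reverseWalk p = reverseOnto p []

  arcs-reverseOnto : ∀ {a b c} (p : Walk G a b) (acc : Walk (G ᵒᵖ) a c) →
    arcs (reverseOnto p acc) ≡ arcs p ʳ++ arcs acc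
  arcs-reverseOnto []              acc = refl
  arcs-reverseOnto (step e refl p) acc = arcs-reverseOnto p (step e refl acc)

  nodes-reverseOnto : ∀ {a b c} (p : Walk G a b) (acc : Walk (G ᵒᵖ) a c) →
    nodes (reverseOnto p acc) ≡ nodesTail p ʳ++ nodes acc
  nodes-reverseOnto []              acc = refl
  nodes-reverseOnto (step e refl p) acc rewrite nodes≡∷nodesTail p = nodes-reverseOnto p (step e refl acc)

  nodesInit-reverseOnto : ∀ {a b c} (p : Walk G a b) (acc : Walk (G ᵒᵖ) a c) →
    nodesInit (reverseOnto p acc) ≡ nodesTail p ʳ++ nodesInit acc
  nodesInit-reverseOnto []              acc = refl
  nodesInit-reverseOnto (step e refl p) acc rewrite nodes≡∷nodesTail p = nodesInit-reverseOnto p (step e refl acc)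

  nodesTail-reverseOnto : ∀ {a b c} (p : Walk G a b) (acc : Walk (G ᵒᵖ) a c) →
    nodesTail (reverseOnto p acc) ≡ nodesInit p ʳ++ nodesTail acc
  nodesTail-reverseOnto []              acc = refl
  nodesTail-reverseOnto (step e refl p) acc =
    trans (nodesTail-reverseOnto p (step e refl acc)) (cong (nodesInit p ʳ++_) (nodes≡∷nodesTail acc))

  All-arcs-reverseWalk : ∀ {a b} {P : Arc G → Set} (p : Walk G a b) → All P (arcs p) → All P (arcs (reverseWalk p))
  All-arcs-reverseWalk {P = P} p ps = subst (All P) (sym (arcs-reverseOnto p [])) (All-reverse ps)

  All-nodes-reverseWalk : ∀ {a b} {S : Node G → Set} (p : Walk G a b) → All S (nodes p) → All S (nodes (reverseWalk p))
  All-nodes-reverseWalk {a} {S = S} p ss =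
    subst (All S) (sym (nodes-reverseOnto p []))
      (All-reverse {xs = a ∷ nodesTail p} (subst (All S) (nodes≡∷nodesTail p) ss))

  reverseWalk-isPath : ∀ {a b} (p : Walk G a b) → IsPath p → IsPath (reverseWalk p)
  reverseWalk-isPath p (init-unique , tail-unique)
    rewrite nodesInit-reverseOnto p [] | nodesTail-reverseOnto p [] =
    Unique-reverse tail-unique , Unique-reverse init-unique

-- Degrees and compression

module _ (G : Graph) where

  JoinNode? : ∀ v → Dec (JoinNode G v)
  JoinNode? v = 1 <? indeg G v

  ¬join⇒inArc-unique : ∀ {v} → ¬ JoinNode G v → ∀ {e e′} → hd G e ≡ v → hd G e′ ≡ v → e ≡ e′
  ¬join⇒inArc-unique {v} ¬join {e} {e′} he he′ with e ≟ e′
  ... | yes e≡e′ = e≡e′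
  ... | no  e≢e′ = ⊥-elim (¬join (distinct-∈⇒1<length (∈inArcs he) (∈inArcs he′) e≢e′))
    where
    ∈inArcs : ∀ {a} → hd G a ≡ v → a ∈ filter (λ a → hd G a ≟ v) (allFin (nArcs G))
    ∈inArcs {a} = ∈-filter⁺ (λ a → hd G a ≟ v) (∈-allFin a)

  join⇒twoInArcs : ∀ {v} → JoinNode G v →
    Σ (Arc G) λ e → hd G e ≡ v × Σ (Arc G) λ e′ → hd G e′ ≡ v × e ≢ e′
  join⇒twoInArcs {v} join
    with e , e′ , e≢e′ , e∈ , e′∈ ← Unique∧1<length⇒distinct-∈ (filter⁺ (λ a → hd G a ≟ v) (allFin⁺ (nArcs G))) join
    = e , proj₂ (∈-filter⁻ (λ a → hd G a ≟ v) {xs = allFin _} e∈)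
    , e′ , proj₂ (∈-filter⁻ (λ a → hd G a ≟ v) {xs = allFin _} e′∈) , e≢e′

SplitNode? : ∀ G v → Dec (SplitNode G v)
SplitNode? G = JoinNode? (G ᵒᵖ)

¬split⇒outArc-unique : ∀ G {v} → ¬ SplitNode G v → ∀ {e e′} → tl G e ≡ v → tl G e′ ≡ v → e ≡ e′
¬split⇒outArc-unique G = ¬join⇒inArc-unique (G ᵒᵖ)

module _ {G : Graph} (compressed : Compressed G) where

  compressedᵒᵖ : Compressed (G ᵒᵖ)
  compressedᵒᵖ = (λ v biuni → proj₁ compressed v (swap biuni)) , (λ e biuni → proj₂ compressed e (swap biuni))

  join⊎split : ∀ v → JoinNode G v ⊎ SplitNode G v
  join⊎split v with JoinNode? G v | SplitNode? G v
  ... | yes join | _         = inj₁ join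
  ... | no  _    | yes split = inj₂ split
  ... | no ¬join | no ¬split = ⊥-elim (proj₁ compressed v (¬join , ¬split))

  ¬split⇒join : ∀ {v} → ¬ SplitNode G v → JoinNode G v
  ¬split⇒join {v} ¬split with join⊎split v
  ... | inj₁ join  = join
  ... | inj₂ split = ⊥-elim (¬split split)

  joinArc⊎splitArc : ∀ e → JoinArc G e ⊎ SplitArc G e
  joinArc⊎splitArc e with JoinNode? G (hd G e) | SplitNode? G (tl G e)
  ... | yes join | _         = inj₁ join
  ... | no  _    | yes split = inj₂ split
  ... | no ¬join | no ¬split = ⊥-elim (proj₂ compressed e (¬join , ¬split))

-- Split-free walks and R⁻(v)

SplitFree : ∀ {G a b} → Walk G a b → Set
SplitFree {G} p = All (SplitFreeArc G) (arcs p)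

∈nodesInit⇒∈nodes : ∀ {G a b x} (p : Walk G a b) → x ∈ nodesInit p → x ∈ nodes p
∈nodesInit⇒∈nodes (step _ _ _) (here x≡a) = here x≡a
∈nodesInit⇒∈nodes (step _ _ p) (there x∈) = there (∈nodesInit⇒∈nodes p x∈)

nodes-unique⇒isPath : ∀ {G a b} (p : Walk G a b) → Unique (nodes p) → IsPath p
nodes-unique⇒isPath []              _                = [] , []
nodes-unique⇒isPath (step _ refl p) (a∉p ∷ p-unique) =
  ¬Any⇒All¬ (nodesInit p) (Unique[x∷xs]⇒x∉xs (a∉p ∷ p-unique) ∘ ∈nodesInit⇒∈nodes p)
    ∷ proj₁ (nodes-unique⇒isPath p p-unique) , p-unique

suffixFrom : ∀ {G a b x} {P : Arc G → Set} (p : Walk G a b) → All P (arcs p) → x ∈ nodes p →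
  Σ (Walk G x b) λ s → length (arcs s) ≤ length (arcs p) × All P (arcs s)
suffixFrom []            _        (here refl) = [] , z≤n , []
suffixFrom (step e eq p) Pp       (here refl) = step e eq p , ≤-refl , Pp
suffixFrom (step e eq p) (_ ∷ Pp) (there x∈p) =
  let s , s≤p , Ps = suffixFrom p Pp x∈p in s , m≤n⇒m≤1+n s≤p , Ps

module _ {G : Graph} where

  splitFree-toSplit-agree : ∀ {x v w} (p : Walk G x v) (q : Walk G x w) → SplitFree p → SplitFree q →
    SplitNode G v → SplitNode G w → v ≡ w × length (arcs p) ≡ length (arcs q)
  splitFree-toSplit-agree []              []              _          _        _       _       = refl , refl
  splitFree-toSplit-agree []              (step _ refl _) _          (sf ∷ _) split-v _       = ⊥-elim (sf split-v)
  splitFree-toSplit-agree (step _ refl _) []              (sf ∷ _)   _        _       split-w = ⊥-elim (sf split-w)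
  splitFree-toSplit-agree (step e refl p) (step e′ eq q) (sf ∷ sfp) (_ ∷ sfq) split-v split-w
    with refl ← ¬split⇒outArc-unique G sf {e} {e′} refl eq
    = let v≡w , |p|≡|q| = splitFree-toSplit-agree p q sfp sfq split-v split-w in v≡w , cong suc |p|≡|q|

  -- A revisited node would give a second, shorter split-free walk from it to v.
  splitFree-toSplit-source∉ : ∀ {v} e (p : Walk G (hd G e) v) → SplitFreeArc G e → SplitFree p →
    SplitNode G v → tl G e ∉ nodes p
  splitFree-toSplit-source∉ e p sf sfp split-v tl∈p =
    let s , |s|≤|p| , sfs = suffixFrom p sfp tl∈p
        _ , |ep|≡|s|      = splitFree-toSplit-agree (step e refl p) s (sf ∷ sfp) sfs split-v split-v
    in <-irrefl (sym |ep|≡|s|) (s≤s |s|≤|p|)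

  splitFree-toSplit-nodesUnique : ∀ {u v} (p : Walk G u v) → SplitFree p → SplitNode G v → Unique (nodes p)
  splitFree-toSplit-nodesUnique []              _          _       = [] ∷ []
  splitFree-toSplit-nodesUnique (step e refl p) (sf ∷ sfp) split-v =
    ¬Any⇒All¬ (nodes p) (splitFree-toSplit-source∉ e p sf sfp split-v)
      ∷ splitFree-toSplit-nodesUnique p sfp split-v

  splitFree⇒Rminus : ∀ {u v} → SplitNode G v → (p : Walk G u v) → SplitFree p → Rminus G v u
  splitFree⇒Rminus split-v p sfp = p , nodes-unique⇒isPath p (splitFree-toSplit-nodesUnique p sfp split-v) , sfp

  Rminus-extend : ∀ {v e} → SplitNode G v → SplitFreeArc G e → Rminus G v (hd G e) → Rminus G v (tl G e)
  Rminus-extend {e = e} split-v sf (p , _ , sfp) = splitFree⇒Rminus split-v (step e refl p) (sf ∷ sfp)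

  Rminus-root : ∀ {v} → Rminus G v v
  Rminus-root = [] , ([] , []) , []

  Rminus-split⇒root : ∀ {v u} → Rminus G v u → SplitNode G u → u ≡ v
  Rminus-split⇒root ([]             , _ , _)      _       = refl
  Rminus-split⇒root (step _ refl _ , _ , sf ∷ _) split-u = ⊥-elim (sf split-u)

  Rminus-unique : ∀ {v w u} → SplitNode G v → SplitNode G w → Rminus G v u → Rminus G w u → v ≡ w
  Rminus-unique split-v split-w (p , _ , sfp) (q , _ , sfq) = proj₁ (splitFree-toSplit-agree p q sfp sfq split-v split-w)

  Rminus⇒join : Compressed G → ∀ {v u} → JoinNode G v → Rminus G v u → JoinNode G u
  Rminus⇒join compressed {u = u} join-v r with join⊎split compressed u
  ... | inj₁ join-u  = join-u
  ... | inj₂ split-u = subst (JoinNode G) (sym (Rminus-split⇒root r split-u)) join-v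

  Rminus-inTree : ∀ {v} → SplitNode G v → InTree G (Rminus G v) (SplitFreeArc G) v
  Rminus-inTree {v} split-v =
    Rminus-root ,
    (λ e sf tl≡v _ → sf (subst (SplitNode G) (sym tl≡v) split-v)) ,
    parentArc ,
    λ u (p , _ , sfp) → p , sfp , Rminus-along p sfp
    where
    parentArc : ∀ u → Rminus G v u → u ≢ v →
      Σ (Arc G) λ e → SplitFreeArc G e × tl G e ≡ u × Rminus G v (hd G e)
        × (∀ e′ → SplitFreeArc G e′ → tl G e′ ≡ u → Rminus G v (hd G e′) → e′ ≡ e)
    parentArc u ([]             , _ , _)          u≢v = ⊥-elim (u≢v refl)
    parentArc u (step e refl p , _ , sf ∷ sfp) _   =
      e , sf , refl , splitFree⇒Rminus split-v p sfp , λ e′ _ tl≡u _ → ¬split⇒outArc-unique G sf tl≡u refl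
    Rminus-along : ∀ {u} (p : Walk G u v) → SplitFree p → All (Rminus G v) (nodes p)
    Rminus-along []              _          = Rminus-root ∷ []
    Rminus-along (step e refl p) (sf ∷ sfp) = splitFree⇒Rminus split-v (step e refl p) (sf ∷ sfp) ∷ Rminus-along p sfp

-- R⁺(v) by duality

Rplus⇒Rminusᵒᵖ : ∀ {G v u} → Rplus G v u → Rminus (G ᵒᵖ) v u
Rplus⇒Rminusᵒᵖ (p , p-path , jfp) = reverseWalk p , reverseWalk-isPath p p-path , All-arcs-reverseWalk p jfp

Rminus⇒Rplusᵒᵖ : ∀ {G v u} → Rminus G v u → Rplus (G ᵒᵖ) v u
Rminus⇒Rplusᵒᵖ (p , p-path , sfp) = reverseWalk p , reverseWalk-isPath p p-path , All-arcs-reverseWalk p sfp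

InMacro⇒InMacroᵒᵖ : ∀ {G v u} → InMacro G v u → InMacro (G ᵒᵖ) v u
InMacro⇒InMacroᵒᵖ (inj₁ r) = inj₂ (Rplus⇒Rminusᵒᵖ r)
InMacro⇒InMacroᵒᵖ (inj₂ r) = inj₁ (Rminus⇒Rplusᵒᵖ r)

inTreeᵒᵖ⇒outTree : ∀ {G} {S S′ : Node G → Set} {A : Arc G → Set} {r} →
  (∀ {x} → S x → S′ x) → (∀ {x} → S′ x → S x) → InTree (G ᵒᵖ) S′ A r → OutTree G S A r
inTreeᵒᵖ⇒outTree to from (S′r , noParent , parentArc , reach) =
  from S′r ,
  (λ e a hd≡r Stl → noParent e a hd≡r (to Stl)) ,
  (λ u Su u≢r → let e , a , hd≡u , Stl , unique = parentArc u (to Su) u≢r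
                in e , a , hd≡u , from Stl , λ e′ a′ hd′≡u Stl′ → unique e′ a′ hd′≡u (to Stl′)) ,
  λ u Su → let p , Ap , S′p = reach u (to Su)
           in reverseWalk p , All-arcs-reverseWalk p Ap , All.map from (All-nodes-reverseWalk p S′p)

module _ {G : Graph} where

  Rplus-root : ∀ {v} → Rplus G v v
  Rplus-root = [] , ([] , []) , []

  Rplus-join⇒root : ∀ {v u} → Rplus G v u → JoinNode G u → u ≡ v
  Rplus-join⇒root r = Rminus-split⇒root (Rplus⇒Rminusᵒᵖ r)

  Rplus-unique : ∀ {v w u} → JoinNode G v → JoinNode G w → Rplus G v u → Rplus G w u → v ≡ w
  Rplus-unique join-v join-w r r′ = Rminus-unique join-v join-w (Rplus⇒Rminusᵒᵖ r) (Rplus⇒Rminusᵒᵖ r′)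

  Rplus⇒split : Compressed G → ∀ {v u} → SplitNode G v → Rplus G v u → SplitNode G u
  Rplus⇒split compressed split-v r = Rminus⇒join (compressedᵒᵖ compressed) split-v (Rplus⇒Rminusᵒᵖ r)

  Rplus-extend : ∀ {v e} → JoinNode G v → JoinFreeArc G e → Rplus G v (tl G e) → Rplus G v (hd G e)
  Rplus-extend join-v jf r = Rminus⇒Rplusᵒᵖ (Rminus-extend join-v jf (Rplus⇒Rminusᵒᵖ r))

  Rplus-outTree : ∀ {v} → JoinNode G v → OutTree G (Rplus G v) (JoinFreeArc G) v
  Rplus-outTree join-v = inTreeᵒᵖ⇒outTree Rplus⇒Rminusᵒᵖ Rminus⇒Rplusᵒᵖ (Rminus-inTree join-v)

-- Macronodes

module _ {G : Graph} (compressed : Compressed G) where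

  Rplus∩Rminus⇒root : ∀ {v u} → Rplus G v u → Rminus G v u → u ≡ v
  Rplus∩Rminus⇒root {u = u} r r′ with join⊎split compressed u
  ... | inj₁ join-u  = Rplus-join⇒root r join-u
  ... | inj₂ split-u = Rminus-split⇒root r′ split-u

  Rplus-Rminus-unique : ∀ {v w u} → BivalentNode G v → BivalentNode G w → Rplus G v u → Rminus G w u → v ≡ w
  Rplus-Rminus-unique {v} {w} {u} (_ , split-v) (join-w , _) r r′ with join⊎split compressed u
  ... | inj₁ join-u  = let u≡v = Rplus-join⇒root r join-u
                       in trans (sym u≡v) (Rminus-split⇒root r′ (subst (SplitNode G) (sym u≡v) split-v))
  ... | inj₂ split-u = let u≡w = Rminus-split⇒root r′ split-u
                       in trans (sym (Rplus-join⇒root r (subst (JoinNode G) (sym u≡w) join-w))) u≡w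

  macronode-unique : ∀ {v w u} → BivalentNode G v → BivalentNode G w → InMacro G v u → InMacro G w u → v ≡ w
  macronode-unique (join-v , _) (join-w , _) (inj₁ r) (inj₁ r′) = Rplus-unique join-v join-w r r′
  macronode-unique (_ , split-v) (_ , split-w) (inj₂ r) (inj₂ r′) = Rminus-unique split-v split-w r r′
  macronode-unique biv-v biv-w (inj₁ r) (inj₂ r′) = Rplus-Rminus-unique biv-v biv-w r r′
  macronode-unique biv-v biv-w (inj₂ r) (inj₁ r′) = sym (Rplus-Rminus-unique biv-w biv-v r′ r)

  InMacro-extend : ∀ {v e} → BivalentNode G v → InMacro G v (tl G e) → JoinFreeArc G e → Rplus G v (hd G e)
  InMacro-extend (join-v , _) (inj₁ r) jf = Rplus-extend join-v jf r
  InMacro-extend {v} {e} (join-v , _) (inj₂ r) jf with joinArc⊎splitArc compressed e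
  ... | inj₁ join     = ⊥-elim (jf join)
  ... | inj₂ split-tl = Rplus-extend join-v jf (subst (Rplus G v) (sym (Rminus-split⇒root r split-tl)) Rplus-root)

  crossingArc⇒joinArc : ∀ {e v w} → BivalentNode G v → BivalentNode G w →
    InMacro G v (tl G e) → InMacro G w (hd G e) → v ≢ w → JoinArc G e
  crossingArc⇒joinArc {e} biv-v biv-w tl∈v hd∈w v≢w with JoinNode? G (hd G e)
  ... | yes join = join
  ... | no  jf   = ⊥-elim (v≢w (macronode-unique biv-v biv-w (inj₁ (InMacro-extend biv-v tl∈v jf)) hd∈w))

SameMacro-refl : ∀ {G v} → SameMacro G v v
SameMacro-refl _ = (λ m → m) , (λ m → m)

crossingArc⇒bivalentArc : ∀ {G} → Compressed G → ∀ {e v w} → BivalentNode G v → BivalentNode G w →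
  InMacro G v (tl G e) → InMacro G w (hd G e) → ¬ SameMacro G v w → BivalentArc G e
crossingArc⇒bivalentArc compressed {v = v} {w} biv-v biv-w tl∈v hd∈w different =
  crossingArc⇒joinArc compressed biv-v biv-w tl∈v hd∈w v≢w ,
  crossingArc⇒joinArc (compressedᵒᵖ compressed) (swap biv-w) (swap biv-v)
    (InMacro⇒InMacroᵒᵖ hd∈w) (InMacro⇒InMacroᵒᵖ tl∈v) (v≢w ∘ sym)
  where
  v≢w : v ≢ w
  v≢w refl = different SameMacro-refl

firstSplitNode : ∀ {G a b} → Walk G a b → SplitNode G b → Σ (Node G) λ y → SplitNode G y × Σ (Walk G a y) SplitFree
firstSplitNode {G} {a} p split-b with SplitNode? G a
... | yes split-a = a , split-a , [] , []
firstSplitNode []              split-b | no ¬split-a = ⊥-elim (¬split-a split-b)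
firstSplitNode (step e refl p) split-b | no ¬split-a =
  let y , split-y , q , sfq = firstSplitNode p split-b in y , split-y , step e refl q , ¬split-a ∷ sfq

StronglyConnectedᵒᵖ : ∀ {G} → StronglyConnected G → StronglyConnected (G ᵒᵖ)
StronglyConnectedᵒᵖ connected u w = reverseWalk (connected w u)

module _ {G : Graph} (compressed : Compressed G) where

  splitFree-preserves-join : ∀ {a y} → JoinNode G a → (q : Walk G a y) → SplitFree q → JoinNode G y
  splitFree-preserves-join join-a []              _          = join-a
  splitFree-preserves-join _      (step e refl q) (sf ∷ sfq) with joinArc⊎splitArc compressed e
  ... | inj₁ join-hd = splitFree-preserves-join join-hd q sfq
  ... | inj₂ split   = ⊥-elim (sf split)

  -- With no split node every node is a join node, and x ↦ (tail of a chosen in-arc of x)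
  -- is injective on the finite node set, hence surjective; so every arc is the chosen
  -- in-arc of its head, contradicting the two distinct in-arcs of a join node.
  splitNode-exists : Node G → Σ (Node G) (SplitNode G)
  splitNode-exists u with any? (SplitNode? G)
  ... | yes split = split
  ... | no  none  =
    let e , hd≡u , e′ , hd′≡u , e≢e′ = join⇒twoInArcs G (join u)
    in ⊥-elim (e≢e′ (trans (sym (inArc-hd e)) (trans (cong inArc (trans hd≡u (sym hd′≡u))) (inArc-hd e′))))
    where
    join : ∀ x → JoinNode G x
    join x = ¬split⇒join compressed (λ split → none (x , split))
    inArc : Node G → Arc G
    inArc x = proj₁ (join⇒twoInArcs G (join x))
    hd-inArc : ∀ x → hd G (inArc x) ≡ x
    hd-inArc x = proj₁ (proj₂ (join⇒twoInArcs G (join x)))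
    inArc≡ : ∀ x a → tl G (inArc x) ≡ tl G a → inArc x ≡ a
    inArc≡ x a tl≡ = ¬split⇒outArc-unique G (λ split → none (tl G a , split)) tl≡ refl
    tl-inArc-injective : Injective _≡_ _≡_ (tl G ∘ inArc)
    tl-inArc-injective {x} {y} tl≡ = trans (sym (hd-inArc x)) (trans (cong (hd G) (inArc≡ x (inArc y) tl≡)) (hd-inArc y))
    inArc-hd : ∀ a → inArc (hd G a) ≡ a
    inArc-hd a =
      let y , tl≡ = injective⇒surjective tl-inArc-injective (tl G a)
          inArc-y≡a = inArc≡ y a tl≡
      in subst (λ z → inArc z ≡ a) (trans (sym (hd-inArc y)) (cong (hd G) inArc-y≡a)) inArc-y≡a

  join⇒Rminus-bivalent : StronglyConnected G → ∀ {u} → JoinNode G u → Σ (Node G) λ v → BivalentNode G v × Rminus G v u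
  join⇒Rminus-bivalent connected {u} join-u =
    let s , split-s = splitNode-exists u
        y , split-y , q , sfq = firstSplitNode (connected u s) split-s
    in y , (splitFree-preserves-join join-u q sfq , split-y) , splitFree⇒Rminus split-y q sfq

macronode-cover : ∀ {G} → StronglyConnected G → Compressed G → ∀ u → Σ (Node G) λ v → BivalentNode G v × InMacro G v u
macronode-cover connected compressed u with join⊎split compressed u
... | inj₁ join-u  = let v , biv-v , r = join⇒Rminus-bivalent compressed connected join-u in v , biv-v , inj₂ r
... | inj₂ split-u =
  let v , biv-v , r = join⇒Rminus-bivalent (compressedᵒᵖ compressed) (StronglyConnectedᵒᵖ connected) split-u
  in v , swap biv-v , inj₁ (Rminus⇒Rplusᵒᵖ r)

lemma14 : (G : Graph) → StronglyConnected G → Compressed G → ¬ IsClosedPath G →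
    -- (i) {V(M_v) : v bivalent} is a partition of V(G)
    ( (∀ u → Σ (Node G) λ v → BivalentNode G v × InMacro G v u)
    × (∀ v → BivalentNode G v → Σ (Node G) λ u → InMacro G v u)
    × (∀ v w → BivalentNode G v → BivalentNode G w →
         ∀ u → InMacro G v u → InMacro G w u → SameMacro G v w) )
    -- (ii) structure of each macronode
    × (∀ v → BivalentNode G v →
         OutTree G (Rplus G v) (JoinFreeArc G) v
         × InTree G (Rminus G v) (SplitFreeArc G) v
         × (∀ u → Rplus G v u → Rminus G v u → u ≡ v)
         × (∀ u → Rminus G v u → JoinNode G u)
         × (∀ u → Rplus G v u → SplitNode G u))
    -- (iii) arcs between different macronodes are bivalent
    × (∀ e v w → BivalentNode G v → BivalentNode G w →
         InMacro G v (tl G e) → InMacro G w (hd G e) → ¬ SameMacro G v w →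
         BivalentArc G e)
-- A closed path has biunivocal nodes, so the last hypothesis already follows from compression.
lemma14 G connected compressed _ =
  ( macronode-cover connected compressed
  , (λ v _ → v , inj₁ Rplus-root)
  , (λ v w biv-v biv-w u u∈v u∈w →
       subst (SameMacro G v) (macronode-unique compressed biv-v biv-w u∈v u∈w) SameMacro-refl) )
  , (λ v (join-v , split-v) →
       Rplus-outTree join-v
     , Rminus-inTree split-v
     , (λ u → Rplus∩Rminus⇒root compressed)
     , (λ u → Rminus⇒join compressed join-v)
     , (λ u → Rplus⇒split compressed split-v))
  , λ e v w → crossingArc⇒bivalentArc compressed
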